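{- Let $h\in\mathbb{Z}[x]$ be intersective with positive leading coefficient, let $d,q\in\mathbb{N}$, $x\in\mathbb{Z}$, and $A\subseteq\mathbb{N}$. If $(A-A)\cap I(h_d)=\emptyset$ and $A'\subseteq\{a\in\mathbb{N}:x+\lambda(q)a\in A\}$, then $(A'-A')\cap I(h_{qd})=\emptyset$.
   Context: $\mathbb{N}=\{1,2,\dots\}$. A polynomial $h\in\mathbb{Z}[x]$ is intersective if it is nonzero and $h(\mathbb{N})$ contains a multiple of every $q\in\mathbb{N}$; equivalently $h$ has a $p$-adic integer root for every prime $p$. For such $h$, fix for each prime $p$ a $p$-adic integer root $z_p$ of $h$, of multiplicity $m_p$. For $d\in\mathbb{N}$ let $r_d$ be the unique integer in $(-d,0]$ with $r_d\equiv z_p\pmod{p^j}$ whenever $p^j$ exactly divides $d$. Let $\lambda$ be the completely multiplicative function on $\mathbb{N}$ with $\lambda(p)=p^{m_p}$ for primes $p$. The auxiliary polynomial is $h_d(x)=h(r_d+dx)/\lambda(d)\in\mathbb{Z}[x]$. For a nonzero $f\in\mathbb{Z}[x]$, $I(f)$ is the set of positive elements of $f(\mathbb{N})$ if $f$ has positive leading coefficient, and the set of negative elements of $f(\mathbb{N})$ if $f$ has negative leading coefficient. $A-A=\{a-b:a,b\in A\}$. -}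

module Defs where

open import Data.Nat as ℕ using (ℕ; zero; suc)
open import Data.Nat.Combinatorics using (_C_)
open import Data.Nat.Primality using (Prime)
import Data.Nat.Divisibility as ℕd
open import Data.Integer using (ℤ; +_; _+_; _-_; _*_; _<_; _≤_; -_)
open import Data.Integer.Divisibility using (_∣_)
open import Data.List using (List; []; _∷_; drop)
open import Data.Product using (Σ; ∃; _×_; _,_)
open import Relation.Nullary using (¬_)
open import Relation.Binary.PropositionalEquality using (_≡_; _≢_)

-- Polynomials in ℤ[x] as coefficient lists, constant term first.
Poly : Set
Poly = List ℤ

eval : Poly → ℤ → ℤ
eval []       x = + 0
eval (c ∷ cs) x = c + x * eval cs x

-- leading coefficient = last nonzero coefficient (0 for the zero polynomial)
lead : Poly → ℤ
lead []       = + 0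
lead (c ∷ cs) with lead cs
... | + 0 = c
... | l   = l

NonZeroPoly : Poly → Set
NonZeroPoly h = lead h ≢ + 0

-- h is intersective: nonzero and h(ℕ), ℕ = {1,2,...}, contains a multiple of every q ∈ ℕ
Intersective : Poly → Set
Intersective h = NonZeroPoly h × (∀ (q : ℕ) → 1 ℕ.≤ q → ∃ λ (n : ℕ) → (+ q) ∣ eval h (+ suc n))

-- k-th Hasse derivative (Taylor coefficient polynomial): Σ_i c_i (i choose k) x^(i-k)
hasseAux : ℕ → ℕ → Poly → Poly
hasseAux k i []       = []
hasseAux k i (c ∷ cs) = c * + (i C k) ∷ hasseAux k (suc i) cs

hasse : ℕ → Poly → Poly
hasse k h = drop k (hasseAux k 0 h)

-- A p-adic integer is represented by a compatible sequence of integers z j,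
-- with z (j+1) ≡ z j (mod p^j); z j represents the residue mod p^j.
IsPAdic : ℕ → (ℕ → ℤ) → Set
IsPAdic p z = ∀ j → (+ (p ℕ.^ j)) ∣ (z (suc j) - z j)

-- g(z) = 0 in ℤ_p
VanishesAt : ℕ → Poly → (ℕ → ℤ) → Set
VanishesAt p g z = ∀ j → (+ (p ℕ.^ j)) ∣ eval g (z j)

-- z is a p-adic root of h of multiplicity m:
-- the Taylor coefficients of order < m vanish at z and the one of order m does not.
IsRootOfMult : ℕ → Poly → (ℕ → ℤ) → ℕ → Set
IsRootOfMult p h z m =
  IsPAdic p z × (∀ k → k ℕ.< m → VanishesAt p (hasse k h) z) × ¬ VanishesAt p (hasse m h) z

ExactlyDivides : ℕ → ℕ → ℕ → Set
ExactlyDivides p j d = (p ℕ.^ j) ℕd.∣ d × ¬ ((p ℕ.^ suc j) ℕd.∣ d)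

IsR : (ℕ → ℕ → ℤ) → ℕ → ℤ → Set
IsR z d r = (- (+ d) < r) × (r ≤ + 0) ×
  (∀ p j → Prime p → ExactlyDivides p j d → (+ (p ℕ.^ j)) ∣ (r - z p j))

IsLambda : (ℕ → ℕ) → (ℕ → ℕ) → Set
IsLambda m lam = (lam 1 ≡ 1) ×
  (∀ a b → 1 ℕ.≤ a → 1 ℕ.≤ b → lam (a ℕ.* b) ≡ lam a ℕ.* lam b) ×
  (∀ p → Prime p → lam p ≡ p ℕ.^ m p)

-- v ∈ I(h_d), where h_d(x) = h(r + d x) / λ(d) with λ(d) = lamd:
-- v = h_d(n) for some n ∈ ℕ = {1,2,...} (i.e. h(r + d n) = λ(d) v), and v has the sign of
-- the leading coefficient of h_d, which is the sign of the leading coefficient of h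
-- (as d > 0 and λ(d) > 0).
InIhd : Poly → ℕ → ℕ → ℤ → ℤ → Set
InIhd h d lamd r v =
  (∃ λ (n : ℕ) → eval h (r + + d * + suc n) ≡ + lamd * v) ×
  (+ 0 < lead h → + 0 < v) × (lead h < + 0 → v < + 0)

DisjointDiff : (ℤ → Set) → Poly → ℕ → ℕ → ℤ → Set
DisjointDiff A h d lamd r = ∀ a b → A a → A b → ¬ InIhd h d lamd r (a - b)

module Submission where

--   (1) r_{qd} ≡ r_d (mod d).  Modulo every prime power p^j dividing d both
--       residues agree with the p-adic root z_p (its residues are coherent), and
--       an integer divisible by every prime power dividing d is divisible by d.
--   (2) Consequently the progression r_{qd} + qd·ℕ lies inside r_d + d·ℕ, using
--       −qd < r_{qd} and r_d ≤ 0 to see that the new index is positive.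
--   (3) λ(qd) = λ(q) λ(d) and λ(q) ≥ 1.
--
-- If a − b = h_{qd}(n) > 0 with a, b ∈ A', then by (2) and (3) the elements
-- x + λ(q)a, x + λ(q)b of A differ by λ(q)(a − b) = h_d(n′) > 0, contradicting
-- the hypothesis on A.

open import Defs

module PrimePowers where
  open import Data.Nat
  open import Data.Nat.Properties
  open import Data.Nat.Divisibility
  open import Data.Nat.Coprimality using (Coprime; coprime-divisor)
  open import Data.Nat.Primality
  open import Data.Nat.Primality.Factorisation using (factorise)
  open import Data.Nat.ListAction using (product)
  open import Data.List using ([]; _∷_)
  open import Data.List.Relation.Unary.All using (All; []; _∷_)
  open import Data.Product using (∃; _,_)
  open import Data.Sum using (inj₁; inj₂)
  open import Data.Empty using (⊥-elim)
  open import Relation.Nullary using (yes; no)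
  open import Relation.Binary.PropositionalEquality

  prime>1 : ∀ {p} → Prime p → 1 < p
  prime>1 pp = nonTrivial⇒n>1 _ {{prime⇒nonTrivial pp}}

  prime≢1 : ∀ {p} → Prime p → p ≢ 1
  prime≢1 pp = nonTrivial⇒≢1 {{prime⇒nonTrivial pp}}

  prime∣prime^⇒≡ : ∀ {p r} → Prime p → Prime r → ∀ i → p ∣ r ^ i → p ≡ r
  prime∣prime^⇒≡ pp pr zero p∣1 = ⊥-elim (prime≢1 pp (∣1⇒≡1 p∣1))
  prime∣prime^⇒≡ {p} {r} pp pr (suc i) p∣r^1+i with euclidsLemma r (r ^ i) pp p∣r^1+i
  ... | inj₂ p∣r^i = prime∣prime^⇒≡ pp pr i p∣r^i
  ... | inj₁ p∣r with prime⇒irreducible pr p∣r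
  ...   | inj₁ p≡1 = ⊥-elim (prime≢1 pp p≡1)
  ...   | inj₂ p≡r = p≡r

  prime^-coprime : ∀ {p r} → Prime p → Prime r → r ≢ p → ∀ i → Coprime (r ^ i) p
  prime^-coprime pp pr r≢p i (c∣r^i , c∣p) with prime⇒irreducible pp c∣p
  ... | inj₁ c≡1 = c≡1
  ... | inj₂ refl = ⊥-elim (r≢p (sym (prime∣prime^⇒≡ pp pr i c∣r^i)))

  PrimePowerDivisorsDivide : ℕ → ℕ → Set
  PrimePowerDivisorsDivide d N = ∀ r i → Prime r → r ^ i ∣ d → r ^ i ∣ N

  -- Local-to-global divisibility for a product of primes: peel off one prime p,
  -- divide N by it, and note that the prime powers of the remaining factor
  -- divide N / p (for r = p by cancelling p, for r ≠ p by coprimality).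
  product∣ : ∀ ps → All Prime ps → ∀ N → PrimePowerDivisorsDivide (product ps) N → product ps ∣ N
  product∣ [] [] N _ = 1∣ N
  product∣ (p ∷ ps) (pp ∷ pps) N divides-N = subst (p * e ∣_) (sym N≡p*N′) (*-monoʳ-∣ p e∣N′)
    where
    instance
      p≢0 : NonZero p
      p≢0 = prime⇒nonZero pp
    e = product ps
    p∣N : p ∣ N
    p∣N = subst (_∣ N) (*-identityʳ p)
            (divides-N p 1 pp (subst (_∣ p * e) (sym (*-identityʳ p)) (m∣m*n e)))
    N′ = quotient p∣N
    N≡p*N′ : N ≡ p * N′
    N≡p*N′ = m∣n⇒n≡m*quotient p∣N
    divides-N′ : PrimePowerDivisorsDivide e N′
    divides-N′ r i pr r^i∣e with r ≟ p
    ... | yes refl = *-cancelˡ-∣ p (subst (r ^ suc i ∣_) N≡p*N′ (divides-N r (suc i) pr (*-monoʳ-∣ r r^i∣e)))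
    ... | no r≢p = coprime-divisor (prime^-coprime pp pr r≢p i)
                     (subst (r ^ i ∣_) N≡p*N′ (divides-N r i pr (∣-trans r^i∣e (n∣m*n p))))
    e∣N′ : e ∣ N′
    e∣N′ = product∣ ps pps N′ divides-N′

  prime-powers⇒∣ : ∀ d → 1 ≤ d → ∀ N → PrimePowerDivisorsDivide d N → d ∣ N
  prime-powers⇒∣ d@(suc _) _ N divides-N with factorise d
  ... | record { factors = ps ; isFactorisation = d≡∏ps ; factorsPrime = pps } =
    subst (_∣ N) (sym d≡∏ps)
      (product∣ ps pps N (λ r i pr r^i∣∏ → divides-N r i pr (subst (r ^ i ∣_) (sym d≡∏ps) r^i∣∏)))

  -- If p^j ∣ d ≠ 0 then p^(j+k) exactly divides d for some k.  The search
  -- increases the exponent; "fuel" bounds it since d < p^j + fuel.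
  exact-power-search : ∀ p → Prime p → ∀ d → .{{NonZero d}} → ∀ fuel j →
    d < p ^ j + fuel → p ^ j ∣ d → ∃ λ k → ExactlyDivides p (j + k) d
  exact-power-search p pp d zero j d<p^j p^j∣d =
    ⊥-elim (<⇒≱ (subst (d <_) (+-identityʳ _) d<p^j) (∣⇒≤ p^j∣d))
  exact-power-search p pp d (suc fuel) j d<bound p^j∣d with p ^ suc j ∣? d
  ... | no p^1+j∤d = 0 , subst (λ t → ExactlyDivides p t d) (sym (+-identityʳ j)) (p^j∣d , p^1+j∤d)
  ... | yes p^1+j∣d with exact-power-search p pp d fuel (suc j) d<bound′ p^1+j∣d
    where
    d<bound′ : d < p ^ suc j + fuel
    d<bound′ = <-≤-trans d<bound (subst (_≤ p ^ suc j + fuel) (sym (+-suc (p ^ j) fuel))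
                 (+-monoˡ-≤ fuel (^-monoʳ-< p (prime>1 pp) (n<1+n j))))
  ... | k , exact = suc k , subst (λ t → ExactlyDivides p t d) (sym (+-suc j k)) exact

  exact-power : ∀ p → Prime p → ∀ d → 1 ≤ d → ∀ j → p ^ j ∣ d →
    ∃ λ k → ExactlyDivides p (j + k) d
  exact-power p pp d@(suc _) _ j = exact-power-search p pp d (suc d) j (m≤n+m _ _)

  λ-positive : ∀ m lam → IsLambda m lam → ∀ q → 1 ≤ q → 1 ≤ lam q
  λ-positive m lam (lam1 , lam-mult , lam-prime) q@(suc _) _ with factorise q
  ... | record { factors = ps ; isFactorisation = q≡∏ps ; factorsPrime = pps } =
    subst (λ t → 1 ≤ lam t) (sym q≡∏ps) (on-products ps pps)
    where
    on-products : ∀ ps → All Prime ps → 1 ≤ lam (product ps)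
    on-products [] [] = ≤-reflexive (sym lam1)
    on-products (p ∷ ps) (pp ∷ pps) =
      subst (1 ≤_) (sym (lam-mult p (product ps) (<⇒≤ (prime>1 pp)) (productOfPrimes≥1 pps)))
        (*-mono-≤ (subst (1 ≤_) (sym (lam-prime p pp)) (m^n>0 p {{prime⇒nonZero pp}} (m p)))
                  (on-products ps pps))

open import Data.Nat as ℕ using (ℕ; suc)
open import Data.Nat.Primality using (Prime)
open import Data.Integer using (ℤ; +_; _+_; _*_; _<_)
open import Data.Product using (_×_)
open import Data.Integer using (_-_; -_; _≤_; ∣_∣; +[1+_]; +<+; +≤+)
import Data.Integer.Properties as ℤ
import Data.Nat.Properties as ℕ
import Data.Nat.Divisibility as ℕ
open import Data.Integer.Divisibility.Signed as Signed using (∣ᵤ⇒∣; ∣⇒∣ᵤ; divides)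
open import Data.Integer.Tactic.RingSolver using (solve-∀)
open import Data.Product using (∃; _,_; proj₁; proj₂)
open import Data.Empty using (⊥-elim)
open import Relation.Binary.PropositionalEquality
open PrimePowers

-- Congruence of integers modulo k (a record, so that a, b, k are inferable).
record _≡_[mod_] (a b k : ℤ) : Set where
  constructor mod
  field k∣a-b : k Signed.∣ (a - b)
open _≡_[mod_]

mod-refl : ∀ {k} a → a ≡ a [mod k ]
mod-refl a = mod (divides (+ 0) (ℤ.+-inverseʳ a))

mod-trans : ∀ {k a b c} → a ≡ b [mod k ] → b ≡ c [mod k ] → a ≡ c [mod k ]
mod-trans {k} {a} {b} {c} (mod k∣a-b) (mod k∣b-c) =
  mod (subst (k Signed.∣_) (sym (telescope a b c)) (Signed.∣m∣n⇒∣m+n k∣a-b k∣b-c))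
  where
  telescope : ∀ (a b c : ℤ) → a - c ≡ (a - b) + (b - c)
  telescope = solve-∀

mod-sym : ∀ {k a b} → a ≡ b [mod k ] → b ≡ a [mod k ]
mod-sym {k} {a} {b} (mod k∣a-b) = mod (subst (k Signed.∣_) (negate-difference a b) (Signed.∣m⇒∣-m k∣a-b))
  where
  negate-difference : ∀ (a b : ℤ) → - (a - b) ≡ b - a
  negate-difference = solve-∀

mod-prime^-weaken : ∀ p j k {a b} → a ≡ b [mod + (p ℕ.^ (j ℕ.+ k)) ] → a ≡ b [mod + (p ℕ.^ j) ]
mod-prime^-weaken p j k (mod m∣a-b) = mod (Signed.∣-trans (∣ᵤ⇒∣ p^j∣p^[j+k]) m∣a-b)
  where
  p^j∣p^[j+k] : p ℕ.^ j ℕ.∣ p ℕ.^ (j ℕ.+ k)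
  p^j∣p^[j+k] = subst (p ℕ.^ j ℕ.∣_) (sym (ℕ.^-distribˡ-+-* p j k)) (ℕ.m∣m*n (p ℕ.^ k))

padic-coherent : ∀ p (zp : ℕ → ℤ) → IsPAdic p zp → ∀ j k → zp (j ℕ.+ k) ≡ zp j [mod + (p ℕ.^ j) ]
padic-coherent p zp _ j ℕ.zero rewrite ℕ.+-identityʳ j = mod-refl (zp j)
padic-coherent p zp coherent j (suc k) rewrite ℕ.+-suc j k =
  mod-trans (mod-prime^-weaken p j k (mod (∣ᵤ⇒∣ (coherent (j ℕ.+ k))))) (padic-coherent p zp coherent j k)

-- r_d agrees with the p-adic root z_p modulo every prime power p^j dividing d:
-- if p^(j+k) ∥ d then r_d ≡ z_p(j+k) ≡ z_p(j) modulo p^j.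
r≡root : ∀ {z d r p j} → IsPAdic p (z p) → IsR z d r → 1 ℕ.≤ d → Prime p →
  p ℕ.^ j ℕ.∣ d → r ≡ z p j [mod + (p ℕ.^ j) ]
r≡root {z} {d} {p = p} {j} coherent (_ , _ , r-agrees) 1≤d pp p^j∣d
  with exact-power p pp d 1≤d j p^j∣d
... | k , p^[j+k]∥d =
  mod-trans (mod-prime^-weaken p j k (mod (∣ᵤ⇒∣ (r-agrees p (j ℕ.+ k) pp p^[j+k]∥d))))
            (padic-coherent p (z p) coherent j k)

-- If d ∣ e then r_e ≡ r_d (mod d): both agree with every z_p modulo every
-- prime power dividing d, and those prime powers determine divisibility by d.
r-congruent : ∀ {z} → (∀ p → Prime p → IsPAdic p (z p)) →
  ∀ {d e rd re} → 1 ℕ.≤ d → 1 ℕ.≤ e → d ℕ.∣ e → IsR z d rd → IsR z e re →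
  re ≡ rd [mod + d ]
r-congruent {z} coherent {d} {e} {rd} {re} 1≤d 1≤e d∣e Rd Re =
  mod (∣ᵤ⇒∣ (prime-powers⇒∣ d 1≤d _ prime-power-divides))
  where
  prime-power-divides : PrimePowerDivisorsDivide d ∣ re - rd ∣
  prime-power-divides p j pp p^j∣d = ∣⇒∣ᵤ (k∣a-b (mod-trans
    (r≡root {j = j} (coherent p pp) Re 1≤e pp (ℕ.∣-trans p^j∣d d∣e))
    (mod-sym (r≡root {j = j} (coherent p pp) Rd 1≤d pp p^j∣d))))

progression-term-above : ∀ e N {re rd} → - (+ e) < re → rd ≤ + 0 → + 0 < (re + + e * + suc N) - rd
progression-term-above e N {re} {rd} -e<re rd≤0 = begin-strict
  + 0                          ≡⟨ sym (ℤ.+-inverseˡ (+ e)) ⟩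
  - (+ e) + + e                <⟨ ℤ.+-monoˡ-< (+ e) -e<re ⟩
  re + + e                     ≤⟨ ℤ.+-monoʳ-≤ re e≤e*[1+N] ⟩
  re + + e * + suc N           ≡⟨ sym (ℤ.+-identityʳ _) ⟩
  (re + + e * + suc N) + + 0   ≤⟨ ℤ.+-monoʳ-≤ (re + + e * + suc N) (ℤ.neg-mono-≤ rd≤0) ⟩
  (re + + e * + suc N) - rd    ∎
  where
  open ℤ.≤-Reasoning
  e≤e*[1+N] : + e ≤ + e * + suc N
  e≤e*[1+N] = subst (+ e ≤_) (ℤ.pos-* e (suc N)) (+≤+ (ℕ.m≤m*n e (suc N)))

positive⇒suc : ∀ s → + 0 < s → ∃ λ n → s ≡ + suc n
positive⇒suc +[1+ n ] _ = n , refl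
positive⇒suc (+ 0) (+<+ ())

-- If r_e ≡ r_d (mod d) with e = q d, −e < r_e and r_d ≤ 0, then the progression
-- r_e + e·ℕ is contained in r_d + d·ℕ: writing r_e − r_d = t d, the term
-- r_e + e(N+1) equals r_d + d s with s = q(N+1) + t, and s > 0 since d s > 0.
progression-⊆ : ∀ d q {rd re} → - (+ (q ℕ.* d)) < re → rd ≤ + 0 → re ≡ rd [mod + d ] →
  ∀ N → ∃ λ N′ → re + + (q ℕ.* d) * + suc N ≡ rd + + d * + suc N′
progression-⊆ d q {rd} {re} -e<re rd≤0 (mod (divides t re-rd≡t*d)) N =
  proj₁ s≡1+N′ , (begin
    re + + (q ℕ.* d) * + suc N  ≡⟨ sym rd+d*s ⟩
    rd + + d * s                ≡⟨ cong (λ u → rd + + d * u) (proj₂ s≡1+N′) ⟩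
    rd + + d * + suc (proj₁ s≡1+N′) ∎)
  where
  open ≡-Reasoning
  s : ℤ
  s = + q * + suc N + t
  re≡rd+t*d : re ≡ rd + t * + d
  re≡rd+t*d = trans (split re rd) (cong (λ u → rd + u) re-rd≡t*d)
    where
    split : ∀ (a b : ℤ) → a ≡ b + (a - b)
    split = solve-∀
  common-term : (rd + t * + d) + (+ q * + d) * + suc N ≡ re + + (q ℕ.* d) * + suc N
  common-term = cong₂ _+_ (sym re≡rd+t*d) (cong (_* + suc N) (sym (ℤ.pos-* q d)))
  rd+d*s : rd + + d * s ≡ re + + (q ℕ.* d) * + suc N
  rd+d*s = trans (expand rd t (+ d) (+ q) (+ suc N)) common-term
    where
    expand : ∀ rd t d q n → rd + d * (q * n + t) ≡ (rd + t * d) + (q * d) * n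
    expand = solve-∀
  s*d≡ : s * + d ≡ (re + + (q ℕ.* d) * + suc N) - rd
  s*d≡ = trans (expand rd t (+ d) (+ q) (+ suc N)) (cong (_- rd) common-term)
    where
    expand : ∀ rd t d q n → (q * n + t) * d ≡ ((rd + t * d) + (q * d) * n) - rd
    expand = solve-∀
  s>0 : + 0 < s
  s>0 = ℤ.*-cancelʳ-<-nonNeg (+ d)
          (subst (_< s * + d) (sym (ℤ.*-zeroˡ (+ d)))
            (subst (+ 0 <_) (sym s*d≡) (progression-term-above (q ℕ.* d) N -e<re rd≤0)))
  s≡1+N′ : ∃ λ N′ → s ≡ + suc N′
  s≡1+N′ = positive⇒suc s s>0

λ-rescale : ∀ {m} {lam : ℕ → ℕ} → IsLambda m lam → ∀ q d → 1 ℕ.≤ q → 1 ℕ.≤ d → ∀ v →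
  + lam (q ℕ.* d) * v ≡ + lam d * (+ lam q * v)
λ-rescale {lam = lam} (_ , lam-mult , _) q d 1≤q 1≤d v = begin
  + lam (q ℕ.* d) * v        ≡⟨ cong (λ l → + l * v) (lam-mult q d 1≤q 1≤d) ⟩
  + (lam q ℕ.* lam d) * v    ≡⟨ cong (_* v) (ℤ.pos-* (lam q) (lam d)) ⟩
  (+ lam q * + lam d) * v    ≡⟨ reassociate (+ lam q) (+ lam d) v ⟩
  + lam d * (+ lam q * v)    ∎
  where
  open ≡-Reasoning
  reassociate : ∀ (a b v : ℤ) → (a * b) * v ≡ b * (a * v)
  reassociate = solve-∀

dilated-difference : ∀ x l a b → (x + l * a) - (x + l * b) ≡ l * (a - b)
dilated-difference = solve-∀

positive-* : ∀ l v → 1 ℕ.≤ l → + 0 < v → + 0 < + l * v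
positive-* (suc l) +[1+ w ] _ _ = +<+ (ℕ.s≤s ℕ.z≤n)
positive-* (suc l) (+ 0) _ (+<+ ())

proposition2 : (h : Poly) → Intersective h → + 0 < lead h →
    (z : ℕ → ℕ → ℤ) → (m : ℕ → ℕ) →
    (∀ p → Prime p → IsRootOfMult p h (z p) (m p)) →
    (lam : ℕ → ℕ) → IsLambda m lam →
    (d q : ℕ) → 1 ℕ.≤ d → 1 ℕ.≤ q → (x : ℤ) →
    (A : ℤ → Set) → (∀ a → A a → + 0 < a) →
    (A' : ℤ → Set) → (∀ a → A' a → (+ 0 < a) × A (x + + lam q * a)) →
    (rd rqd : ℤ) → IsR z d rd → IsR z (q ℕ.* d) rqd →
    DisjointDiff A h d (lam d) rd →
    DisjointDiff A' h (q ℕ.* d) (lam (q ℕ.* d)) rqd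
proposition2 h _ lead>0 z m roots lam Λ d q 1≤d 1≤q x A _ A' A'⊆slice rd rqd Rd Rqd disjoint
  a b a∈A' b∈A' ((n , h-value) , a-b>0 , _) =
  disjoint (x + lq * a) (x + lq * b) (proj₂ (A'⊆slice a a∈A')) (proj₂ (A'⊆slice b b∈A'))
    ((n′ , h-value′) , (λ _ → difference>0) , λ lead<0 → ⊥-elim (ℤ.<-asym lead>0 lead<0))
  where
  lq : ℤ
  lq = + lam q
  rqd≡rd : rqd ≡ rd [mod + d ]
  rqd≡rd = r-congruent (λ p pp → proj₁ (roots p pp)) 1≤d (ℕ.*-mono-≤ 1≤q 1≤d) (ℕ.n∣m*n q) Rd Rqd
  same-argument : ∃ λ N′ → rqd + + (q ℕ.* d) * + suc n ≡ rd + + d * + suc N′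
  same-argument = progression-⊆ d q (proj₁ Rqd) (proj₁ (proj₂ Rd)) rqd≡rd n
  n′ : ℕ
  n′ = proj₁ same-argument
  h-value′ : eval h (rd + + d * + suc n′) ≡ + lam d * ((x + lq * a) - (x + lq * b))
  h-value′ = begin
    eval h (rd + + d * + suc n′)             ≡⟨ cong (eval h) (sym (proj₂ same-argument)) ⟩
    eval h (rqd + + (q ℕ.* d) * + suc n)     ≡⟨ h-value ⟩
    + lam (q ℕ.* d) * (a - b)                ≡⟨ λ-rescale {m} Λ q d 1≤q 1≤d (a - b) ⟩
    + lam d * (lq * (a - b))                 ≡⟨ cong (+ lam d *_) (sym (dilated-difference x lq a b)) ⟩
    + lam d * ((x + lq * a) - (x + lq * b))  ∎
    where open ≡-Reasoning
  difference>0 : + 0 < (x + lq * a) - (x + lq * b)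
  difference>0 = subst (+ 0 <_) (sym (dilated-difference x lq a b))
                   (positive-* (lam q) (a - b) (λ-positive m lam Λ q 1≤q) (a-b>0 lead>0))
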